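{- In $\mathsf{2CH}$, for every agent $a$, the modality $\Box_a$ satisfies axiom $\mathsf K$: $\vdash_a\Box_a(\Phi\to\Psi)\to(\Box_a\Phi\to\Box_a\Psi)$ for all world formulas $\Phi,\Psi$; and the modality $[a]$ satisfies axiom $\mathsf K$: $\vdash_e[a](\varphi\to\psi)\to([a]\varphi\to[a]\psi)$ for all agent formulas $\varphi,\psi$ of sort $a$.
   Context: Syntax. Fix a finite set $\mathcal{A}$ of agents, sets $AP_a$ ($a\in\mathcal A$) and $AP_e$ of atomic propositions. Agent formulas of sort $a$: $\varphi ::= p_a \mid \neg\varphi \mid \varphi\wedge\psi \mid \Diamond_a\Phi$ ($p_a\in AP_a$, $\Phi$ a world formula). World formulas: $\Phi ::= p_e \mid \neg\Phi \mid \Phi\wedge\Psi \mid \langle a\rangle\varphi$ ($p_e\in AP_e$, $\varphi$ of sort $a$). Abbreviations: usual $\top,\bot,\vee,\to$; $\Box_a\Phi:=\neg\Diamond_a\neg\Phi$; $[a]\varphi:=\neg\langle a\rangle\neg\varphi$. Proof system. $\vdash_a$, $\vdash_e$ are the least relations containing all propositional tautology instances at each sort, closed under modus ponens at each sort, and under: from $\vdash_e\Phi$ infer $\vdash_a\Box_a\Phi$; from $\vdash_a\varphi$ infer $\vdash_e[a]\varphi$; from $\vdash_e\Phi\to\Psi$ infer $\vdash_a\Diamond_a\Phi\to\Diamond_a\Psi$ and $\vdash_a\Box_a\Phi\to\Box_a\Psi$; from $\vdash_a\varphi\to\psi$ infer $\vdash_e\langle a\rangle\varphi\to\langle a\rangle\psi$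 and $\vdash_e[a]\varphi\to[a]\psi$; $\vdash_e\Phi\to[a]\psi$ iff $\vdash_a\Diamond_a\Phi\to\psi$; $\vdash_a\varphi\to\Box_a\Psi$ iff $\vdash_e\langle a\rangle\varphi\to\Psi$; axioms $\vdash_a\varphi\to\Diamond_a\langle a\rangle\varphi$, $\vdash_a\Diamond_a\langle a\rangle\varphi\to\varphi$, $\vdash_e\bigvee_{a\in\mathcal A}\langle a\rangle\top$. -}

module Defs where

open import Data.Nat using (ℕ)
open import Data.Fin using (Fin)
open import Data.Bool using (Bool; true; false; not; _∧_)
open import Data.List using (List; foldr; allFin)
open import Relation.Binary.PropositionalEquality using (_≡_)

-- Propositional formulas over a set of variables X (schemata for
-- tautology instances).
data PForm (X : Set) : Set where
  var  : X → PForm X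
  ptop : PForm X
  pneg : PForm X → PForm X
  pand : PForm X → PForm X → PForm X

evalP : ∀ {X : Set} → (X → Bool) → PForm X → Bool
evalP v (var x)    = v x
evalP v ptop       = true
evalP v (pneg p)   = not (evalP v p)
evalP v (pand p q) = evalP v p ∧ evalP v q

Tautology : ∀ {X : Set} → PForm X → Set
Tautology {X} p = (v : X → Bool) → evalP v p ≡ true

module 2CH (n : ℕ) (AP : Fin n → Set) (APe : Set) where

  Agent : Set
  Agent = Fin n

  mutual
    data AForm (a : Agent) : Set where
      ⊤a    : AForm a
      atomA : AP a → AForm a
      ¬a_   : AForm a → AForm a
      _∧a_  : AForm a → AForm a → AForm a
      ◇_    : WForm → AForm a

    data WForm : Set where
      ⊤e    : WForm
      atomE : APe → WForm
      ¬e_   : WForm → WForm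
      _∧e_  : WForm → WForm → WForm
      ⟨_⟩_  : (a : Agent) → AForm a → WForm

  infixr 6 _∧a_ _∧e_
  infixr 5 _∨a_ _∨e_
  infixr 4 _⇒a_ _⇒e_

  _∨a_ : ∀ {a} → AForm a → AForm a → AForm a
  φ ∨a ψ = ¬a ((¬a φ) ∧a (¬a ψ))

  _⇒a_ : ∀ {a} → AForm a → AForm a → AForm a
  φ ⇒a ψ = ¬a (φ ∧a (¬a ψ))

  _∨e_ : WForm → WForm → WForm
  Φ ∨e Ψ = ¬e ((¬e Φ) ∧e (¬e Ψ))

  _⇒e_ : WForm → WForm → WForm
  Φ ⇒e Ψ = ¬e (Φ ∧e (¬e Ψ))

  ⊥e : WForm
  ⊥e = ¬e ⊤e

  ◇[_]_ : (a : Agent) → WForm → AForm a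
  ◇[ a ] Φ = ◇ Φ

  □[_]_ : (a : Agent) → WForm → AForm a
  □[ a ] Φ = ¬a (◇[ a ] (¬e Φ))

  [_]_ : (a : Agent) → AForm a → WForm
  [ a ] φ = ¬e (⟨ a ⟩ (¬a φ))

  instA : ∀ {a} {X : Set} → (X → AForm a) → PForm X → AForm a
  instA σ (var x)    = σ x
  instA σ ptop       = ⊤a
  instA σ (pneg p)   = ¬a instA σ p
  instA σ (pand p q) = instA σ p ∧a instA σ q

  instE : ∀ {X : Set} → (X → WForm) → PForm X → WForm
  instE σ (var x)    = σ x
  instE σ ptop       = ⊤e
  instE σ (pneg p)   = ¬e instE σ p
  instE σ (pand p q) = instE σ p ∧e instE σ q

  bigOrAgents : WForm
  bigOrAgents = foldr (λ a Φ → (⟨ a ⟩ ⊤a) ∨e Φ) ⊥e (allFin n)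

  mutual
    data ⊢a_ {a : Agent} : AForm a → Set where
      tautA  : (p : PForm ℕ) (σ : ℕ → AForm a) →
               Tautology p → ⊢a instA σ p
      mpA    : ∀ {φ ψ} → ⊢a (φ ⇒a ψ) → ⊢a φ → ⊢a ψ
      necA   : ∀ {Φ} → ⊢e Φ → ⊢a (□[ a ] Φ)
      mono◇  : ∀ {Φ Ψ} → ⊢e (Φ ⇒e Ψ) → ⊢a ((◇[ a ] Φ) ⇒a (◇[ a ] Ψ))
      mono□  : ∀ {Φ Ψ} → ⊢e (Φ ⇒e Ψ) → ⊢a ((□[ a ] Φ) ⇒a (□[ a ] Ψ))
      adjA→  : ∀ {Φ ψ} → ⊢e (Φ ⇒e ([ a ] ψ)) → ⊢a ((◇[ a ] Φ) ⇒a ψ)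
      adjA←  : ∀ {φ Ψ} → ⊢e ((⟨ a ⟩ φ) ⇒e Ψ) → ⊢a (φ ⇒a (□[ a ] Ψ))
      unitA  : ∀ {φ} → ⊢a (φ ⇒a (◇[ a ] (⟨ a ⟩ φ)))
      counitA : ∀ {φ} → ⊢a ((◇[ a ] (⟨ a ⟩ φ)) ⇒a φ)

    data ⊢e_ : WForm → Set where
      tautE  : (p : PForm ℕ) (σ : ℕ → WForm) →
               Tautology p → ⊢e instE σ p
      mpE    : ∀ {Φ Ψ} → ⊢e (Φ ⇒e Ψ) → ⊢e Φ → ⊢e Ψ
      necE   : ∀ {a} {φ : AForm a} → ⊢a φ → ⊢e ([ a ] φ)
      mono⟨⟩ : ∀ {a} {φ ψ : AForm a} → ⊢a (φ ⇒a ψ) →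
               ⊢e ((⟨ a ⟩ φ) ⇒e (⟨ a ⟩ ψ))
      mono[] : ∀ {a} {φ ψ : AForm a} → ⊢a (φ ⇒a ψ) →
               ⊢e (([ a ] φ) ⇒e ([ a ] ψ))
      adjE←  : ∀ {a} {Φ} {ψ : AForm a} → ⊢a ((◇[ a ] Φ) ⇒a ψ) →
               ⊢e (Φ ⇒e ([ a ] ψ))
      adjE→  : ∀ {a} {φ : AForm a} {Ψ} → ⊢a (φ ⇒a (□[ a ] Ψ)) →
               ⊢e ((⟨ a ⟩ φ) ⇒e Ψ)
      agentsE : ⊢e bigOrAgents

{-# OPTIONS --safe #-}
module Submission where

open import Defs
open import Data.Nat using (ℕ; zero; suc)
open import Data.Fin using (Fin)
open import Data.Bool using (true; false)
open import Data.Product using (_×_; _,_)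
open import Relation.Binary.PropositionalEquality using (_≡_; refl; cong; cong₂; subst)

-- The rules  ⊢a φ ⇒ □Ψ  iff  ⊢e ⟨a⟩φ ⇒ Ψ  make □_a right adjoint to ⟨a⟩ on
-- provable implication, so □_a preserves conjunction: from the counits
-- ⊢e ⟨a⟩□X ⇒ X and modus ponens under ⟨a⟩ one gets
-- ⊢e ⟨a⟩(□(Φ ⇒ Ψ) ∧ □Φ) ⇒ Ψ, hence ⊢a □(Φ ⇒ Ψ) ∧ □Φ ⇒ □Ψ, and currying
-- yields K.  The case of [a] is dual, using the adjunction ◇_a ⊣ [a].

_⇒p_ : PForm ℕ → PForm ℕ → PForm ℕ
p ⇒p q = pneg (pand p (pneg q))

infixr 4 _⇒p_

p₀ p₁ p₂ : PForm ℕ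
p₀ = var 0
p₁ = var 1
p₂ = var 2

∧-elimˡ-schema ∧-elimʳ-schema ⇒-distrib-schema curry-schema : PForm ℕ
∧-elimˡ-schema   = pand p₀ p₁ ⇒p p₀
∧-elimʳ-schema   = pand p₀ p₁ ⇒p p₁
⇒-distrib-schema = (p₀ ⇒p p₁ ⇒p p₂) ⇒p (p₀ ⇒p p₁) ⇒p p₀ ⇒p p₂
curry-schema     = (pand p₀ p₁ ⇒p p₂) ⇒p p₀ ⇒p p₁ ⇒p p₂

∧-elimˡ-tautology : Tautology ∧-elimˡ-schema
∧-elimˡ-tautology v with v 0 | v 1
... | true  | true  = refl
... | true  | false = refl
... | false | _     = refl

∧-elimʳ-tautology : Tautology ∧-elimʳ-schema
∧-elimʳ-tautology v with v 0 | v 1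
... | true  | true  = refl
... | true  | false = refl
... | false | _     = refl

⇒-distrib-tautology : Tautology ⇒-distrib-schema
⇒-distrib-tautology v with v 0 | v 1 | v 2
... | true  | true  | true  = refl
... | true  | true  | false = refl
... | true  | false | _     = refl
... | false | _     | _     = refl

curry-tautology : Tautology curry-schema
curry-tautology v with v 0 | v 1 | v 2
... | true  | true  | true  = refl
... | true  | true  | false = refl
... | true  | false | _     = refl
... | false | _     | _     = refl

module Connectives {F : Set} (⊤ : F) (¬_ : F → F) (_∧_ : F → F → F) where

  _⇒_ : F → F → F
  x ⇒ y = ¬ (x ∧ (¬ y))

  instantiate : (ℕ → F) → PForm ℕ → F
  instantiate σ (var i)    = σ i
  instantiate σ ptop       = ⊤
  instantiate σ (pneg p)   = ¬ instantiate σ p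
  instantiate σ (pand p q) = instantiate σ p ∧ instantiate σ q

  module ClassicalRules
    (⊢_ : F → Set)
    (taut : ∀ p σ → Tautology p → ⊢ instantiate σ p)
    (mp : ∀ {x y} → ⊢ (x ⇒ y) → ⊢ x → ⊢ y)
    where

    private
      σ : F → F → F → ℕ → F
      σ x y z zero          = x
      σ x y z (suc zero)    = y
      σ x y z (suc (suc _)) = z

    ∧-elimˡ : ∀ x y → ⊢ ((x ∧ y) ⇒ x)
    ∧-elimˡ x y = taut ∧-elimˡ-schema (σ x y x) ∧-elimˡ-tautology

    ∧-elimʳ : ∀ x y → ⊢ ((x ∧ y) ⇒ y)
    ∧-elimʳ x y = taut ∧-elimʳ-schema (σ x y x) ∧-elimʳ-tautology

    ⇒-ap : ∀ {x y z} → ⊢ (x ⇒ (y ⇒ z)) → ⊢ (x ⇒ y) → ⊢ (x ⇒ z)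
    ⇒-ap {x} {y} {z} ⊢x⇒y⇒z ⊢x⇒y =
      mp (mp (taut ⇒-distrib-schema (σ x y z) ⇒-distrib-tautology) ⊢x⇒y⇒z) ⊢x⇒y

    curry : ∀ {x y z} → ⊢ ((x ∧ y) ⇒ z) → ⊢ (x ⇒ (y ⇒ z))
    curry {x} {y} {z} = mp (taut curry-schema (σ x y z) curry-tautology)

module _ (n : ℕ) (AP : Fin n → Set) (APe : Set) where
  open 2CH n AP APe

  instA≡instantiate : ∀ {a} σ p → instA {a} σ p ≡ Connectives.instantiate ⊤a ¬a_ _∧a_ σ p
  instA≡instantiate σ (var i)    = refl
  instA≡instantiate σ ptop       = refl
  instA≡instantiate σ (pneg p)   = cong ¬a_ (instA≡instantiate σ p)
  instA≡instantiate σ (pand p q) = cong₂ _∧a_ (instA≡instantiate σ p) (instA≡instantiate σ q)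

  instE≡instantiate : ∀ σ p → instE σ p ≡ Connectives.instantiate ⊤e ¬e_ _∧e_ σ p
  instE≡instantiate σ (var i)    = refl
  instE≡instantiate σ ptop       = refl
  instE≡instantiate σ (pneg p)   = cong ¬e_ (instE≡instantiate σ p)
  instE≡instantiate σ (pand p q) = cong₂ _∧e_ (instE≡instantiate σ p) (instE≡instantiate σ q)

  ⊢a-tautology : ∀ {a} p σ → Tautology p → ⊢a Connectives.instantiate ⊤a ¬a_ (_∧a_ {a}) σ p
  ⊢a-tautology p σ t = subst ⊢a_ (instA≡instantiate σ p) (tautA p σ t)

  ⊢e-tautology : ∀ p σ → Tautology p → ⊢e Connectives.instantiate ⊤e ¬e_ _∧e_ σ p
  ⊢e-tautology p σ t = subst ⊢e_ (instE≡instantiate σ p) (tautE p σ t)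

  private
    module A {a : Agent} = Connectives.ClassicalRules ⊤a ¬a_ _∧a_ (⊢a_ {a}) ⊢a-tautology mpA
    module E = Connectives.ClassicalRules ⊤e ¬e_ _∧e_ ⊢e_ ⊢e-tautology mpE

  □-mp : ∀ a Φ Ψ → ⊢a ((□[ a ] (Φ ⇒e Ψ)) ∧a (□[ a ] Φ) ⇒a □[ a ] Ψ)
  □-mp a Φ Ψ = adjA← (E.⇒-ap (adjE→ (A.∧-elimˡ _ _)) (adjE→ (A.∧-elimʳ _ _)))

  []-mp : ∀ a (φ ψ : AForm a) → ⊢e (([ a ] (φ ⇒a ψ)) ∧e ([ a ] φ) ⇒e [ a ] ψ)
  []-mp a φ ψ = adjE← (A.⇒-ap (adjA→ (E.∧-elimˡ _ _)) (adjA→ (E.∧-elimʳ _ _)))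

  □-K : ∀ a Φ Ψ → ⊢a ((□[ a ] (Φ ⇒e Ψ)) ⇒a ((□[ a ] Φ) ⇒a (□[ a ] Ψ)))
  □-K a Φ Ψ = A.curry (□-mp a Φ Ψ)

  []-K : ∀ a (φ ψ : AForm a) → ⊢e (([ a ] (φ ⇒a ψ)) ⇒e (([ a ] φ) ⇒e ([ a ] ψ)))
  []-K a φ ψ = E.curry ([]-mp a φ ψ)

mainTheorem5 : (n : ℕ) (AP : Fin n → Set) (APe : Set) →
    let open 2CH n AP APe in
    (∀ (a : Agent) (Φ Ψ : WForm) →
       ⊢a ((□[ a ] (Φ ⇒e Ψ)) ⇒a ((□[ a ] Φ) ⇒a (□[ a ] Ψ))))
    × (∀ (a : Agent) (φ ψ : AForm a) →
       ⊢e (([ a ] (φ ⇒a ψ)) ⇒e (([ a ] φ) ⇒e ([ a ] ψ))))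
mainTheorem5 n AP APe = □-K n AP APe , []-K n AP APe
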